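{- The modal logic $\mathsf{S4}$ is complete for finite transitive reflexive provability models with necessitation, local soundness and local completeness: if $A\in\mathcal L_\Box$ holds at every world of every such model, then $\mathsf{S4}\vdash A$.
   Context: $\mathsf{S4}$ is $\mathsf K$ (the smallest normal modal logic) plus $\Box A\to\Box\Box A$ and $\Box A\to A$. Language $\mathcal L_\Box$: formulas built from atomic propositions and $\bot$ using $\to$ and a unary $\Box$. A formula is purely modal if it is a Boolean combination of formulas $\Box B$. A theory is a pair of a set of axioms and a set of inference rules (finitely many premises, one conclusion); $\mathsf T\vdash A$ means derivability from axioms by rules. A theory is classical if modus ponens is one of its rules and all classical tautologies are derivable. A provability pre-model is $\mathcal P=(W,\sqsubset,\{L_w\}_{w\in W^\sqsubset},V)$ with $W$ nonempty, $\sqsubset$ a binary relation on $W$, $V\subseteq W\times\mathrm{atoms}$, $W^\sqsubset=\{u:\exists v\,(v\sqsubset u)\}$, and a theory $L_w$ for each $w\in W^\sqsubset$. Satisfaction: atoms via $V$, $\bot$ never holds, $\to$ classical, $\mathcal P,w\Vdash\Box A$ iff $L_u\vdash A$ for all $u$ with $w\sqsubset u$. With $\sqsubset^+$ the transitive closure, $\mathcal P,w\Vdash^+A$ iff there is $u\sqsubset w$ with $\mathcal P,v\Vdash A$ for all $v$ such that $u\sqsubset^+v$. A provability model is a pre-model in which every $L_w$ is classical and which satisfies modal completeness: for every $w\in W^\sqsubset$ and purely modal $A$, $\mathcal P,w\Vdash^+A$ implies $L_w\vdash A$. Necessitation: every $L_w$ has the rule "from $A$ infer $\Box A$". Local completeness: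 for every $w\in W^\sqsubset$ and every formula $A$, $\mathcal P,w\Vdash^+A$ implies $L_w\vdash A$. Local soundness: for every $w\in W^\sqsubset$ and every $A$, $L_w\vdash A$ implies $\mathcal P,w\Vdash A$. -}

module Defs where

open import Data.Nat using (ℕ; suc)
open import Data.Fin using (Fin)
open import Data.Bool using (Bool; true; false; _∨_; not)
open import Data.List using (List; []; _∷_)
open import Data.List.Relation.Unary.All using (All)
open import Data.Product using (Σ; ∃; _×_; _,_)
open import Data.Sum using (_⊎_)
open import Data.Empty using (⊥)
open import Relation.Binary.PropositionalEquality using (_≡_)
open import Relation.Binary.Construct.Closure.Transitive using (TransClosure)

infixr 5 _⇒_
data Fm : Set where
  atom : ℕ → Fm
  ⊥'   : Fm
  _⇒_  : Fm → Fm → Fm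
  □    : Fm → Fm

data PurelyModal : Fm → Set where
  pm-□ : ∀ B → PurelyModal (□ B)
  pm-⊥ : PurelyModal ⊥'
  pm-⇒ : ∀ {A B} → PurelyModal A → PurelyModal B → PurelyModal (A ⇒ B)

-- Classical tautologies: true under every Boolean valuation of the
-- propositionally atomic subformulas (atoms and boxed formulas).
eval : (Fm → Bool) → Fm → Bool
eval v (atom p) = v (atom p)
eval v ⊥'       = false
eval v (A ⇒ B)  = not (eval v A) ∨ eval v B
eval v (□ A)    = v (□ A)

Tautology : Fm → Set
Tautology A = ∀ (v : Fm → Bool) → eval v A ≡ true

Rule : Set
Rule = List Fm × Fm

record Theory : Set₁ where
  field
    Axiom  : Fm → Set
    IsRule : Rule → Set
open Theory public

infix 3 _⊢_
data _⊢_ (T : Theory) : Fm → Set where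
  ax   : ∀ {A} → Axiom T A → T ⊢ A
  rule : ∀ {ps A} → IsRule T (ps , A) → All (T ⊢_) ps → T ⊢ A

data MP : Rule → Set where
  mp : ∀ A B → MP ((A ∷ (A ⇒ B) ∷ []) , B)

data Nec : Rule → Set where
  nec : ∀ A → Nec ((A ∷ []) , □ A)

data S4Axiom : Fm → Set where
  taut : ∀ {A} → Tautology A → S4Axiom A
  axK  : ∀ A B → S4Axiom (□ (A ⇒ B) ⇒ (□ A ⇒ □ B))
  ax4  : ∀ A → S4Axiom (□ A ⇒ □ (□ A))
  axT  : ∀ A → S4Axiom (□ A ⇒ A)

S4 : Theory
S4 = record { Axiom = S4Axiom ; IsRule = λ r → MP r ⊎ Nec r }

Classical : Theory → Set
Classical T = (∀ A B → IsRule T ((A ∷ (A ⇒ B) ∷ []) , B))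
            × (∀ A → Tautology A → T ⊢ A)

-- The theories L w are given for all worlds, but only those for w ∈ W^⊏
-- are ever used (by satisfaction and by all conditions below).
record PreModel (n : ℕ) : Set₁ where
  field
    _⊏_ : Fin (suc n) → Fin (suc n) → Set
    L   : Fin (suc n) → Theory
    V   : Fin (suc n) → ℕ → Set

module _ {n : ℕ} (P : PreModel n) where
  open PreModel P

  W : Set
  W = Fin (suc n)

  InW⊏ : W → Set
  InW⊏ w = ∃ λ v → v ⊏ w

  infix 4 _⊩_
  _⊩_ : W → Fm → Set
  w ⊩ atom p = V w p
  w ⊩ ⊥'     = ⊥
  w ⊩ A ⇒ B  = w ⊩ A → w ⊩ B
  w ⊩ □ A    = ∀ u → w ⊏ u → L u ⊢ A

  infix 4 _⊩⁺_
  _⊩⁺_ : W → Fm → Set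
  w ⊩⁺ A = ∃ λ u → u ⊏ w × (∀ v → TransClosure _⊏_ u v → v ⊩ A)

  IsTransitive : Set
  IsTransitive = ∀ {u v w} → u ⊏ v → v ⊏ w → u ⊏ w

  IsReflexive : Set
  IsReflexive = ∀ w → w ⊏ w

  AllClassical : Set
  AllClassical = ∀ w → InW⊏ w → Classical (L w)

  ModalComplete : Set
  ModalComplete = ∀ w → InW⊏ w → ∀ A → PurelyModal A → w ⊩⁺ A → L w ⊢ A

  IsProvabilityModel : Set
  IsProvabilityModel = AllClassical × ModalComplete

  Necessitation : Set
  Necessitation = ∀ w → InW⊏ w → ∀ A → IsRule (L w) ((A ∷ []) , □ A)

  LocalComplete : Set
  LocalComplete = ∀ w → InW⊏ w → ∀ A → w ⊩⁺ A → L w ⊢ A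

  LocalSound : Set
  LocalSound = ∀ w → InW⊏ w → ∀ A → L w ⊢ A → w ⊩ A

  Good : Set
  Good = IsProvabilityModel × IsTransitive × IsReflexive
       × Necessitation × LocalSound × LocalComplete

module Submission where

open import Defs
open import Data.Nat using (ℕ; zero; suc; _<_) renaming (_≟_ to _≟ℕ_)
open import Data.Nat.Induction using (<-wellFounded)
open import Data.Fin using (Fin)
open import Data.Fin.Properties using (all?)
open import Data.Bool using (Bool; true; false; _∨_; not)
open import Data.Bool.Properties using (_≟_; ¬-not; not-¬)
open import Data.List using (List; []; _∷_; _++_; map; foldr; length; lookup; filter)
open import Data.List.Properties using (filter-notAll)
open import Data.List.Relation.Unary.All as All using (All; []; _∷_)
open import Data.List.Relation.Unary.All.Properties using (¬All⇒Any¬; map⁺; map⁻)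
open import Data.List.Relation.Unary.Any as Any using (Any; here; there; any?)
open import Data.List.Relation.Unary.Any.Properties using (lookup-index)
open import Data.List.Membership.Propositional using (_∈_; find; lose)
open import Data.List.Membership.Propositional.Properties
  using (∈-map⁺; ∈-++⁺ˡ; ∈-++⁺ʳ; ∈-++⁻; ∈-filter⁺; ∈-filter⁻; ∈-lookup)
open import Data.List.Relation.Binary.Subset.Propositional using (_⊆_)
open import Data.Product using (Σ-syntax; _×_; _,_; proj₁; proj₂)
open import Data.Sum using (_⊎_; inj₁; inj₂; map₂)
open import Data.Empty using (⊥; ⊥-elim)
open import Function using (_∘_; id; _⇔_; mk⇔; Equivalence)
open import Induction.WellFounded using (Acc; acc)
open import Level using (0ℓ)
open import Relation.Binary.Core using (Rel)
open import Relation.Binary.Definitions using (Decidable; Reflexive; Transitive)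
open import Relation.Binary.PropositionalEquality using (_≡_; _≢_; refl; sym; trans; cong; cong₂)
open import Relation.Binary.Construct.Closure.Transitive using ([_])
open import Relation.Nullary using (Dec; yes; no; ¬_; does; _×-dec_; _→-dec_)
open import Relation.Nullary.Decidable using (dec-true)

-- Propositionally, A only depends on the values of its atoms and boxed
-- subformulas, so a countermodel can be sought among the finitely many Boolean
-- assignments to them.  Starting
-- from all assignments, repeatedly discard those that violate the T-axiom or
-- lack a successor refuting a false box; each discarded assignment v has its
-- characteristic formula refuted in S4 (¬χ_v is derivable).  The survivors
-- carry a finite reflexive transitive Kripke model, which is a provability model
-- by taking as theory of w everything true at all successors of w.  If A fails
-- at a survivor, this is a countermodel; otherwise A follows propositionally
-- from the derivable formulas ¬χ_v, so S4 ⊢ A.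

⇒ᵇ-elim : ∀ {a b} → not a ∨ b ≡ true → a ≡ true → b ≡ true
⇒ᵇ-elim {true}  b≡true refl = b≡true
⇒ᵇ-elim {false} _      ()

⇒ᵇ-intro : ∀ {a b} → (a ≡ true → b ≡ true) → not a ∨ b ≡ true
⇒ᵇ-intro {false} _ = refl
⇒ᵇ-intro {true}  h = h refl

⇒-elim : ∀ f {A B} → eval f (A ⇒ B) ≡ true → eval f A ≡ true → eval f B ≡ true
⇒-elim f = ⇒ᵇ-elim

⇒-intro : ∀ f {A B} → (eval f A ≡ true → eval f B ≡ true) → eval f (A ⇒ B) ≡ true
⇒-intro f = ⇒ᵇ-intro

Holds : (Fm → Bool) → List Fm → Set
Holds f = All (λ P → eval f P ≡ true)

imps : List Fm → Fm → Fm
imps Ps Y = foldr _⇒_ Y Ps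

eval-imps-intro : ∀ f Ps {Y} → (Holds f Ps → eval f Y ≡ true) → eval f (imps Ps Y) ≡ true
eval-imps-intro f []       h = h []
eval-imps-intro f (P ∷ Ps) {Y} h = ⇒-intro f {P} {imps Ps Y} λ p → eval-imps-intro f Ps (h ∘ (p ∷_))

eval-imps-elim : ∀ f {Ps Y} → eval f (imps Ps Y) ≡ true → Holds f Ps → eval f Y ≡ true
eval-imps-elim f             y []       = y
eval-imps-elim f {P ∷ Ps} {Y} y (p ∷ ps) = eval-imps-elim f (⇒-elim f {P} {imps Ps Y} y p) ps

module _ {T : Theory} (classical : Classical T) where

  ⊢-mp : ∀ {A B} → T ⊢ A → T ⊢ A ⇒ B → T ⊢ B
  ⊢-mp {A} {B} a a⇒b = rule (proj₁ classical A B) (a ∷ a⇒b ∷ [])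

  ⊢-tautological : ∀ {Ps Y} → All (T ⊢_) Ps → (∀ f → Holds f Ps → eval f Y ≡ true) → T ⊢ Y
  ⊢-tautological {Y = Y} [] h = proj₂ classical Y (λ f → h f [])
  ⊢-tautological {P ∷ _} {Y} (d ∷ ds) h =
    ⊢-mp d (⊢-tautological ds λ f ps → ⇒-intro f {P} {Y} λ p → h f (p ∷ ps))

S4-classical : Classical S4
S4-classical = (λ A B → inj₁ (mp A B)) , (λ A t → ax (taut t))

⊢-nec : ∀ {A} → S4 ⊢ A → S4 ⊢ □ A
⊢-nec {A} d = rule (inj₂ (nec A)) (d ∷ [])

⊢□-imps : ∀ Ps Y → S4 ⊢ □ (imps Ps Y) ⇒ imps (map □ Ps) (□ Y)
⊢□-imps []       Y = ax (taut λ f → ⇒-intro f {□ Y} {□ Y} id)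
⊢□-imps (P ∷ Ps) Y = ⊢-tautological S4-classical (ax (axK P R) ∷ ⊢□-imps Ps Y ∷ [])
  λ { f (k ∷ ih ∷ []) →
        ⇒-intro f {□ (P ⇒ R)} {□ P ⇒ R′} λ □[P⇒R] → ⇒-intro f {□ P} {R′} λ □P →
        ⇒-elim f {□ R} {R′} ih (⇒-elim f {□ P} {□ R} (⇒-elim f {□ (P ⇒ R)} {□ P ⇒ □ R} k □[P⇒R]) □P) }
  where
  R R′ : Fm
  R  = imps Ps Y
  R′ = imps (map □ Ps) (□ Y)

⊢-lift : ∀ Ps {Y} → S4 ⊢ imps Ps Y → S4 ⊢ imps (map □ Ps) (□ Y)
⊢-lift Ps d = ⊢-mp S4-classical (⊢-nec d) (⊢□-imps Ps _)

⊢-nec-under-boxes : ∀ Γ {C} → S4 ⊢ imps (map □ Γ) C → S4 ⊢ imps (map □ Γ) (□ C)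
⊢-nec-under-boxes Γ d =
  ⊢-tautological S4-classical (⊢-lift (map □ Γ) d ∷ map⁺ (All.universal (ax ∘ ax4) Γ))
    λ { f (lifted ∷ fours) → eval-imps-intro f (map □ Γ) λ □Γ →
          eval-imps-elim f lifted (map⁺ (map⁺ (All.zipWith (λ {D} (four , □D) → ⇒-elim f {□ D} {□ (□ D)} four □D)
                                                            (map⁻ fours , map⁻ □Γ)))) }

_≟F_ : (X Y : Fm) → Dec (X ≡ Y)
atom p ≟F atom q with p ≟ℕ q
... | yes refl = yes refl
... | no p≢q   = no λ { refl → p≢q refl }
⊥' ≟F ⊥' = yes refl
(A ⇒ B) ≟F (A' ⇒ B') with A ≟F A' | B ≟F B'
... | yes refl | yes refl = yes refl
... | no A≢A'  | _        = no λ { refl → A≢A' refl }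
... | yes _    | no B≢B'  = no λ { refl → B≢B' refl }
□ A ≟F □ A' with A ≟F A'
... | yes refl = yes refl
... | no A≢A'  = no λ { refl → A≢A' refl }
atom _  ≟F ⊥'      = no λ ()
atom _  ≟F (_ ⇒ _) = no λ ()
atom _  ≟F □ _     = no λ ()
⊥'      ≟F atom _  = no λ ()
⊥'      ≟F (_ ⇒ _) = no λ ()
⊥'      ≟F □ _     = no λ ()
(_ ⇒ _) ≟F atom _  = no λ ()
(_ ⇒ _) ≟F ⊥'      = no λ ()
(_ ⇒ _) ≟F □ _     = no λ ()
□ _     ≟F atom _  = no λ ()
□ _     ≟F ⊥'      = no λ ()
□ _     ≟F (_ ⇒ _) = no λ ()

-- letters A are the subformulas of A that eval treats as atoms; boxes A are the
-- C with □ C a subformula of A.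
letters boxes : Fm → List Fm
letters (atom p) = atom p ∷ []
letters ⊥'       = []
letters (A ⇒ B)  = letters A ++ letters B
letters (□ B)    = □ B ∷ letters B

boxes (atom p) = []
boxes ⊥'       = []
boxes (A ⇒ B)  = boxes A ++ boxes B
boxes (□ B)    = B ∷ boxes B

∈-++-map : ∀ {F G : Fm → List Fm} A B {X Y} → (X ∈ F A → Y ∈ G A) → (X ∈ F B → Y ∈ G B)
         → X ∈ F A ++ F B → Y ∈ G A ++ G B
∈-++-map {F} {G} A B hA hB X∈ with ∈-++⁻ (F A) X∈
... | inj₁ X∈A = ∈-++⁺ˡ (hA X∈A)
... | inj₂ X∈B = ∈-++⁺ʳ (G A) (hB X∈B)

□∈letters⇒∈boxes : ∀ A {C} → □ C ∈ letters A → C ∈ boxes A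
□∈letters⇒∈boxes (atom p) (here ())
□∈letters⇒∈boxes (A ⇒ B)  = ∈-++-map A B (□∈letters⇒∈boxes A) (□∈letters⇒∈boxes B)
□∈letters⇒∈boxes (□ B)    (here refl) = here refl
□∈letters⇒∈boxes (□ B)    (there C∈) = there (□∈letters⇒∈boxes B C∈)

∈boxes⇒□∈letters : ∀ A {C} → C ∈ boxes A → □ C ∈ letters A
∈boxes⇒□∈letters (A ⇒ B) = ∈-++-map A B (∈boxes⇒□∈letters A) (∈boxes⇒□∈letters B)
∈boxes⇒□∈letters (□ B)   (here refl) = here refl
∈boxes⇒□∈letters (□ B)   (there C∈) = there (∈boxes⇒□∈letters B C∈)

letters-boxes-⊆ : ∀ A {C} → C ∈ boxes A → letters C ⊆ letters A
letters-boxes-⊆ (A ⇒ B) C∈ X∈ with ∈-++⁻ (boxes A) C∈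
... | inj₁ C∈A = ∈-++⁺ˡ (letters-boxes-⊆ A C∈A X∈)
... | inj₂ C∈B = ∈-++⁺ʳ (letters A) (letters-boxes-⊆ B C∈B X∈)
letters-boxes-⊆ (□ B) (here refl) X∈ = there X∈
letters-boxes-⊆ (□ B) (there C∈)  X∈ = there (letters-boxes-⊆ B C∈ X∈)

eval-letter : ∀ f A {X} → X ∈ letters A → eval f X ≡ f X
eval-letter f (atom p) (here refl) = refl
eval-letter f (A ⇒ B) X∈ with ∈-++⁻ (letters A) X∈
... | inj₁ X∈A = eval-letter f A X∈A
... | inj₂ X∈B = eval-letter f B X∈B
eval-letter f (□ B) (here refl) = refl
eval-letter f (□ B) (there X∈)  = eval-letter f B X∈

eval-cong : ∀ f g C → (∀ {X} → X ∈ letters C → f X ≡ g X) → eval f C ≡ eval g C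
eval-cong f g (atom p) f≗g = f≗g (here refl)
eval-cong f g ⊥'       f≗g = refl
eval-cong f g (A ⇒ B)  f≗g =
  cong₂ (λ a b → not a ∨ b) (eval-cong f g A (f≗g ∘ ∈-++⁺ˡ)) (eval-cong f g B (f≗g ∘ ∈-++⁺ʳ (letters A)))
eval-cong f g (□ B)    f≗g = f≗g (here refl)

assignment : List Fm → List Bool → Fm → Bool
assignment (Y ∷ Ys) (b ∷ bs) X with X ≟F Y
... | yes _ = b
... | no _  = assignment Ys bs X
assignment _ _ _ = false

assignment-map : ∀ f Ys {X} → X ∈ Ys → assignment Ys (map f Ys) X ≡ f X
assignment-map f (Y ∷ Ys) {X} X∈ with X ≟F Y | X∈
... | yes refl | _        = refl
... | no X≢Y   | here X≡Y = ⊥-elim (X≢Y X≡Y)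
... | no _     | there X∈ = assignment-map f Ys X∈

boolLists : ℕ → List (List Bool)
boolLists zero    = [] ∷ []
boolLists (suc k) = map (true ∷_) (boolLists k) ++ map (false ∷_) (boolLists k)

map-∈-boolLists : ∀ (f : Fm → Bool) Ys → map f Ys ∈ boolLists (length Ys)
map-∈-boolLists f []       = here refl
map-∈-boolLists f (Y ∷ Ys) with f Y
... | true  = ∈-++⁺ˡ (∈-map⁺ (true ∷_) (map-∈-boolLists f Ys))
... | false = ∈-++⁺ʳ (map (true ∷_) (boolLists (length Ys))) (∈-map⁺ (false ∷_) (map-∈-boolLists f Ys))

dec-true⁻ : ∀ {a} {A : Set a} (a? : Dec A) → does a? ≡ true → A
dec-true⁻ (yes a) _ = a

module FiniteKripke {n : ℕ} (_≺_ : Rel (Fin (suc n)) 0ℓ) (_≺?_ : Decidable _≺_)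
                    (≺-refl : Reflexive _≺_) (≺-trans : Transitive _≺_)
                    (V : Fin (suc n) → ℕ → Bool) where

  infix 4.5 _⊨_
  _⊨_ : Fin (suc n) → Fm → Bool
  i ⊨ atom p = V i p
  i ⊨ ⊥'     = false
  i ⊨ A ⇒ B  = not (i ⊨ A) ∨ (i ⊨ B)
  i ⊨ □ B    = does (all? (λ j → i ≺? j →-dec (j ⊨ B ≟ true)))

  ⊨□-intro : ∀ i B → (∀ j → i ≺ j → j ⊨ B ≡ true) → i ⊨ □ B ≡ true
  ⊨□-intro i B = dec-true (all? (λ j → i ≺? j →-dec (j ⊨ B ≟ true)))

  ⊨□-elim : ∀ i B → i ⊨ □ B ≡ true → ∀ j → i ≺ j → j ⊨ B ≡ true
  ⊨□-elim i B = dec-true⁻ (all? (λ j → i ≺? j →-dec (j ⊨ B ≟ true)))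

  theory : Fin (suc n) → Theory
  theory i = record { Axiom  = λ B → ∀ j → i ≺ j → j ⊨ B ≡ true
                    ; IsRule = λ r → MP r ⊎ Nec r }

  model : PreModel n
  model = record { _⊏_ = _≺_ ; L = theory ; V = λ i p → V i p ≡ true }

  theory-sound : ∀ {i B} → theory i ⊢ B → ∀ j → i ≺ j → j ⊨ B ≡ true
  theory-sound (ax B-valid) = B-valid
  theory-sound (rule (inj₁ (mp A B)) (a ∷ a⇒b ∷ [])) j i≺j =
    ⇒ᵇ-elim (theory-sound a⇒b j i≺j) (theory-sound a j i≺j)
  theory-sound (rule (inj₂ (nec A)) (a ∷ [])) j i≺j =
    ⊨□-intro j A λ k j≺k → theory-sound a k (≺-trans i≺j j≺k)

  truth : ∀ i C → _⊩_ model i C ⇔ (i ⊨ C ≡ true)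
  truth i (atom p) = mk⇔ id id
  truth i ⊥'       = mk⇔ (λ ()) (λ ())
  truth i (A ⇒ B)  = mk⇔
    (λ h → ⇒ᵇ-intro (Equivalence.to (truth i B) ∘ h ∘ Equivalence.from (truth i A)))
    (λ h → Equivalence.from (truth i B) ∘ ⇒ᵇ-elim h ∘ Equivalence.to (truth i A))
  truth i (□ B)    = mk⇔
    (λ h → ⊨□-intro i B λ j i≺j → theory-sound (h j i≺j) j ≺-refl)
    (λ h j i≺j → ax λ k j≺k → ⊨□-elim i B h k (≺-trans i≺j j≺k))

  eval-⊨ : ∀ i C → eval (i ⊨_) C ≡ i ⊨ C
  eval-⊨ i (atom p) = refl
  eval-⊨ i ⊥'       = refl
  eval-⊨ i (A ⇒ B)  = cong₂ (λ a b → not a ∨ b) (eval-⊨ i A) (eval-⊨ i B)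
  eval-⊨ i (□ B)    = refl

  good : Good model
  good = ((λ _ _ → (λ A B → inj₁ (mp A B)) , λ A taut → ax λ j _ → trans (sym (eval-⊨ j A)) (taut (j ⊨_)))
         , (λ w w∈ A _ → local-complete w w∈ A))
       , ≺-trans
       , (λ _ → ≺-refl)
       , (λ _ _ A → inj₂ (nec A))
       , (λ w _ A ⊢A → Equivalence.from (truth w A) (theory-sound ⊢A w ≺-refl))
       , local-complete
    where
    local-complete : LocalComplete model
    local-complete w _ A (u , u≺w , h) =
      ax λ k w≺k → Equivalence.to (truth k A) (h k [ ≺-trans u≺w w≺k ])

Valid : Fm → Set₁
Valid A = ∀ (n : ℕ) (P : PreModel n) → Good P → ∀ w → _⊩_ P w A

module Elimination (A₀ : Fm) where

  Ls Bx : List Fm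
  Ls = letters A₀
  Bx = boxes A₀

  World : Set
  World = List Bool

  worlds : List World
  worlds = boolLists (length Ls)

  val : World → Fm → Bool
  val = assignment Ls

  ⟦_⟧ : Fm → World → Bool
  ⟦ C ⟧ v = eval (val v) C

  restrict : (Fm → Bool) → World
  restrict f = map f Ls

  restrict-val : ∀ f {X} → X ∈ Ls → val (restrict f) X ≡ f X
  restrict-val f = assignment-map f Ls

  restrict-agree : ∀ f C → letters C ⊆ Ls → eval f C ≡ ⟦ C ⟧ (restrict f)
  restrict-agree f C C⊆ = eval-cong f _ C (sym ∘ restrict-val f ∘ C⊆)

  literal : Fm → Bool → Fm
  literal X true  = X
  literal X false = X ⇒ ⊥'

  literal-holds : ∀ f X {b} → eval f (literal X b) ≡ true → eval f X ≡ b
  literal-holds f X {true}  X-true = X-true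
  literal-holds f X {false} ¬X-true with eval f X
  ... | false = refl
  literal-holds f X {false} () | true

  literal-of-eval : ∀ f X → eval f (literal X (eval f X)) ≡ true
  literal-of-eval f X with eval f X in eq
  ... | true  = eq
  ... | false rewrite eq = refl

  χ : World → List Fm
  χ v = map (λ X → literal X (val v X)) Ls

  ¬χ : World → Fm
  ¬χ v = imps (χ v) ⊥'

  χ-val : ∀ f {v} → Holds f (χ v) → ∀ {X} → X ∈ Ls → f X ≡ val v X
  χ-val f χ-holds {X} X∈ =
    trans (sym (eval-letter f A₀ X∈)) (literal-holds f X (All.lookup (map⁻ χ-holds) X∈))

  χ-agree : ∀ f {v} C → Holds f (χ v) → letters C ⊆ Ls → eval f C ≡ ⟦ C ⟧ v
  χ-agree f C χ-holds C⊆ = eval-cong f _ C (χ-val f χ-holds ∘ C⊆)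

  χ-restrict : ∀ f → Holds f (χ (restrict f))
  χ-restrict f = map⁺ (All.tabulate literal-restrict)
    where
    literal-restrict : ∀ {X} → X ∈ Ls → eval f (literal X (val (restrict f) X)) ≡ true
    literal-restrict {X} X∈ rewrite restrict-val f X∈ | sym (eval-letter f A₀ X∈) = literal-of-eval f X

  Refuted : World → Set
  Refuted v = S4 ⊢ ¬χ v

  refute-by : ∀ {v Y} → S4 ⊢ Y → (∀ f → Holds f (χ v) → eval f Y ≡ true → ⊥) → Refuted v
  refute-by {v} ⊢Y absurd = ⊢-tautological S4-classical (⊢Y ∷ [])
    λ { f (y ∷ []) → eval-imps-intro f (χ v) λ χ-holds → ⊥-elim (absurd f χ-holds y) }

  infix 4 _≺_
  _≺_ : World → World → Set
  u ≺ v = All (λ C → val u (□ C) ≡ true → val v (□ C) ≡ true) Bx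

  _≺?_ : Decidable _≺_
  u ≺? v = All.all? (λ C → val u (□ C) ≟ true →-dec val v (□ C) ≟ true) Bx

  ≺-refl : Reflexive _≺_
  ≺-refl = All.universal (λ _ → id) Bx

  ≺-trans : Transitive _≺_
  ≺-trans u≺v v≺w = All.zipWith (λ (f , g) → g ∘ f) (u≺v , v≺w)

  SaturatedAt : List World → World → Fm → Set
  SaturatedAt S v C = (val v (□ C) ≡ true → ⟦ C ⟧ v ≡ true)
                    × (val v (□ C) ≡ false → Any (λ u → v ≺ u × ⟦ C ⟧ u ≡ false) S)

  saturatedAt? : ∀ S v C → Dec (SaturatedAt S v C)
  saturatedAt? S v C =
          (val v (□ C) ≟ true →-dec ⟦ C ⟧ v ≟ true)
    ×-dec (val v (□ C) ≟ false →-dec any? (λ u → v ≺? u ×-dec ⟦ C ⟧ u ≟ false) S)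

  Saturated : List World → World → Set
  Saturated S v = All (SaturatedAt S v) Bx

  saturated? : ∀ S v → Dec (Saturated S v)
  saturated? S v = All.all? (saturatedAt? S v) Bx

  data Defect (S : List World) (v : World) : Set where
    box-fails  : ∀ {C} → C ∈ Bx → val v (□ C) ≡ true → ⟦ C ⟧ v ≡ false → Defect S v
    no-witness : ∀ {C} → C ∈ Bx → val v (□ C) ≡ false
               → (∀ {u} → u ∈ S → v ≺ u → ⟦ C ⟧ u ≡ true) → Defect S v

  defect : ∀ {S v} → ¬ Saturated S v → Defect S v
  defect {S} {v} unsat with find (¬All⇒Any¬ (saturatedAt? S v) Bx unsat)
  ... | C , C∈Bx , unsat-at with val v (□ C) in □C≡
  ... | true  = box-fails C∈Bx □C≡ (¬-not λ C-true → unsat-at ((λ _ → C-true) , λ ()))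
  ... | false = no-witness C∈Bx □C≡ λ u∈S v≺u →
                  ¬-not λ C-false → unsat-at ((λ ()) , λ _ → lose u∈S (v≺u , C-false))

  Covers : List World → Set
  Covers S = All (λ u → u ∈ S ⊎ Refuted u) worlds

  refutations : ∀ {S us} → All (λ u → u ∈ S ⊎ Refuted u) us
              → Σ[ ps ∈ List Fm ] All (S4 ⊢_) ps × All (λ u → u ∈ S ⊎ ¬χ u ∈ ps) us
  refutations [] = [] , [] , []
  refutations (inj₁ u∈S ∷ cov) with refutations cov
  ... | ps , ⊢ps , covered = ps , ⊢ps , inj₁ u∈S ∷ covered
  refutations {us = u ∷ _} (inj₂ ⊢¬χu ∷ cov) with refutations cov
  ... | ps , ⊢ps , covered =
    ¬χ u ∷ ps , ⊢¬χu ∷ ⊢ps , inj₂ (here refl) ∷ All.map (map₂ there) covered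

  valid-on⇒⊢ : ∀ {S Y} → Covers S → (∀ f → restrict f ∈ S → eval f Y ≡ true) → S4 ⊢ Y
  valid-on⇒⊢ {Y = Y} cov valid-on-S with refutations cov
  ... | ps , ⊢ps , covered = ⊢-tautological S4-classical ⊢ps valid
    where
    valid : ∀ f → Holds f ps → eval f Y ≡ true
    valid f ps-hold with All.lookup covered (map-∈-boolLists f Ls)
    ... | inj₁ restrict-f∈S = valid-on-S f restrict-f∈S
    ... | inj₂ ¬χ∈ps with eval-imps-elim f (All.lookup ps-hold ¬χ∈ps) (χ-restrict f)
    ...   | ()

  refute : ∀ {S v} → Covers S → ¬ Saturated S v → Refuted v
  refute {S} {v} cov unsat with defect unsat
  ... | box-fails {C} C∈Bx □C-true C-false = refute-by (ax (axT C)) λ f χ-holds □C⇒C →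
    not-¬ (trans (sym (χ-agree f C χ-holds (letters-boxes-⊆ A₀ C∈Bx)))
                 (⇒-elim f {□ C} {C} □C⇒C (trans (χ-val f χ-holds (∈boxes⇒□∈letters A₀ C∈Bx)) □C-true)))
          C-false
  ... | no-witness {C} C∈Bx □C-false C-above =
    refute-by (⊢-nec-under-boxes Γ (valid-on⇒⊢ cov C-above-Γ)) λ f χ-holds □Γ⇒□C →
      not-¬ (eval-imps-elim f □Γ⇒□C (map⁺ (All.tabulate λ D∈Γ →
               let D∈Bx , □D-true = ∈-filter⁻ (λ D → val v (□ D) ≟ true) D∈Γ
               in trans (χ-val f χ-holds (∈boxes⇒□∈letters A₀ D∈Bx)) □D-true)))
            (trans (χ-val f χ-holds (∈boxes⇒□∈letters A₀ C∈Bx)) □C-false)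
    where
    Γ : List Fm
    Γ = filter (λ D → val v (□ D) ≟ true) Bx

    C-above-Γ : ∀ f → restrict f ∈ S → eval f (imps (map □ Γ) C) ≡ true
    C-above-Γ f f∈S = eval-imps-intro f (map □ Γ) λ □Γ →
      trans (restrict-agree f C (letters-boxes-⊆ A₀ C∈Bx)) (C-above f∈S (All.tabulate λ {D} D∈Bx □D-true →
        trans (restrict-val f (∈boxes⇒□∈letters A₀ D∈Bx))
              (All.lookup (map⁻ □Γ) (∈-filter⁺ (λ D → val v (□ D) ≟ true) D∈Bx □D-true))))

  prune : List World → List World
  prune S = filter (saturated? S) S

  prune-covers : ∀ {S} → Covers S → Covers (prune S)
  prune-covers {S} cov = All.map keep cov
    where
    keep : ∀ {u} → u ∈ S ⊎ Refuted u → u ∈ prune S ⊎ Refuted u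
    keep (inj₂ refuted) = inj₂ refuted
    keep {u} (inj₁ u∈S) with saturated? S u
    ... | yes sat   = inj₁ (∈-filter⁺ (saturated? S) u∈S sat)
    ... | no  unsat = inj₂ (refute cov unsat)

  saturate : ∀ S → Covers S → Acc _<_ (length S)
           → Σ[ S' ∈ List World ] Covers S' × All (Saturated S') S'
  saturate S cov (acc smaller) with All.all? (saturated? S) S
  ... | yes sat   = S , cov , sat
  ... | no  unsat = saturate (prune S) (prune-covers cov)
                      (smaller (filter-notAll (saturated? S) S (¬All⇒Any¬ (saturated? S) S unsat)))

  module Canonical (x : World) (xs : List World) (sat : All (Saturated (x ∷ xs)) (x ∷ xs)) where

    world : Fin (suc (length xs)) → World
    world = lookup (x ∷ xs)

    open FiniteKripke (λ i j → world i ≺ world j) (λ i j → world i ≺? world j) ≺-refl ≺-trans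
                      (λ i p → val (world i) (atom p)) public

    saturated-at : ∀ j {B} → B ∈ Bx → SaturatedAt (x ∷ xs) (world j) B
    saturated-at j = All.lookup (All.lookup sat (∈-lookup j))

    ⊨□-correct : ∀ i {B} → B ∈ Bx → (∀ j → j ⊨ B ≡ ⟦ B ⟧ (world j)) → i ⊨ □ B ≡ ⟦ □ B ⟧ (world i)
    ⊨□-correct i {B} B∈Bx ⊨B-correct with val (world i) (□ B) in □B≡
    ... | true  = ⊨□-intro i B λ j i≺j →
          trans (⊨B-correct j) (proj₁ (saturated-at j B∈Bx) (All.lookup i≺j B∈Bx □B≡))
    ... | false = ¬-not λ i⊨□B →
          not-¬ (trans (sym (⊨B-correct j)) (⊨□-elim i B i⊨□B j i≺j)) B-false
      where
      witness : Any (λ u → world i ≺ u × ⟦ B ⟧ u ≡ false) (x ∷ xs)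
      witness = proj₂ (saturated-at i B∈Bx) □B≡
      j : Fin (suc (length xs))
      j = Any.index witness
      i≺j : world i ≺ world j
      i≺j = proj₁ (lookup-index witness)
      B-false : ⟦ B ⟧ (world j) ≡ false
      B-false = proj₂ (lookup-index witness)

    ⊨-correct : ∀ i C → letters C ⊆ Ls → i ⊨ C ≡ ⟦ C ⟧ (world i)
    ⊨-correct i (atom p) _  = refl
    ⊨-correct i ⊥'       _  = refl
    ⊨-correct i (A ⇒ B)  C⊆ =
      cong₂ (λ a b → not a ∨ b) (⊨-correct i A (C⊆ ∘ ∈-++⁺ˡ)) (⊨-correct i B (C⊆ ∘ ∈-++⁺ʳ (letters A)))
    ⊨-correct i (□ B)    C⊆ =
      ⊨□-correct i (□∈letters⇒∈boxes A₀ (C⊆ (here refl))) λ j → ⊨-correct j B (C⊆ ∘ there)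

  no-countermodel : ∀ {S} → All (Saturated S) S → Any (λ v → ⟦ A₀ ⟧ v ≢ true) S → ¬ Valid A₀
  no-countermodel {x ∷ xs} sat refuting valid =
    lookup-index refuting (trans (sym (⊨-correct j A₀ id)) (Equivalence.to (truth j A₀) (valid _ model good j)))
    where
    open Canonical x xs sat
    j : Fin (suc (length xs))
    j = Any.index refuting

  valid⇒⊢ : Valid A₀ → S4 ⊢ A₀
  valid⇒⊢ valid with saturate worlds (All.tabulate inj₁) (<-wellFounded _)
  ... | S , cov , sat with All.all? (λ v → ⟦ A₀ ⟧ v ≟ true) S
  ... | yes A₀-holds = valid-on⇒⊢ cov λ f f∈S → trans (restrict-agree f A₀ id) (All.lookup A₀-holds f∈S)
  ... | no  A₀-fails = ⊥-elim (no-countermodel sat (¬All⇒Any¬ (λ v → ⟦ A₀ ⟧ v ≟ true) S A₀-fails) valid)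

theorem3p12 : ∀ (A : Fm)
    → (∀ (n : ℕ) (P : PreModel n) → Good P → ∀ w → _⊩_ P w A)
    → S4 ⊢ A
theorem3p12 A = Elimination.valid⇒⊢ A
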